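{- Let $M=(W,\mathcal{B},\mathcal{O},\mathcal{D},\mathfrak{n},\|\cdot\|)$ be a model, $w\in W$, and let $AF^M=(\mathsf{A}^M,\rightsquigarrow)$ be its associated argumentation framework with grounded extension $GE(AF^M)$. Then: (1) $AF^M$ satisfies direct consistency: there are no $\alpha,\beta\in\mathsf{A}$ and $\varphi,\psi\in\mathsf{F}$ with $M,w\models\mathsf{B}(\alpha,\varphi)\land\mathsf{B}(\beta,\psi)\land\varphi=\sim\psi$. (2) If the defeat relation is defined using restricted rebuttal instead of unrestricted rebuttal, and $\mathcal{O}=\mathsf{A}$, then $AF^M$ satisfies direct consistency (as in (1)); indirect consistency: $\mathsf{Conc}(GE(AF^M))\nvdash_0\perp$; sub-argument closure: $\alpha\in GE(AF^M)$ implies $\mathsf{sub_A}(\alpha)\subseteq GE(AF^M)$; and strict closure: $\mathsf{Conc}(GE(AF^M))\vdash_0\varphi$ implies $\varphi\in\mathsf{Conc}(GE(AF^M))$.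
   Context: Fix a countable set $\mathsf{At}$ of propositional letters. The language $\mathcal{L}=(\mathsf{F},\mathsf{A})$ of formulas and arguments is generated by $\varphi::= p \mid \lnot\varphi \mid (\varphi\land\varphi) \mid \square\varphi \mid \mathsf{aware}(\alpha) \mid \mathsf{conc}(\alpha)=\varphi \mid \mathsf{strict}(\alpha) \mid \mathsf{undercuts}(\alpha,\alpha) \mid \mathsf{wellshap}(\alpha)$ and $\alpha::= \langle\varphi\rangle \mid \langle\alpha_1,\dots,\alpha_n\twoheadrightarrow\varphi\rangle \mid \langle\alpha_1,\dots,\alpha_n\Rightarrow\varphi\rangle$ ($n\ge1$). $\vdash_0$ is classical propositional consequence. For arguments (with $\hookrightarrow\in\{\twoheadrightarrow,\Rightarrow\}$): $\mathsf{Conc}$ returns the final formula ($\mathsf{Conc}(\langle\varphi\rangle)=\mathsf{Conc}(\langle\dots\hookrightarrow\varphi\rangle)=\varphi$), and for a set $X$ of arguments $\mathsf{Conc}(X)=\{\mathsf{Conc}(\alpha):\alpha\in X\}$; $\mathsf{Prem}(\langle\varphi\rangle)=\{\varphi\}$, $\mathsf{Prem}(\langle\alpha_1,\dots,\alpha_n\hookrightarrow\varphi\rangle)=\bigcup_i\mathsf{Prem}(\alpha_i)$; $\mathsf{sub_A}(\langle\varphi\rangle)=\{\langle\varphi\rangle\}$, $\mathsf{sub_A}(\beta)=\{\beta\}\cup\bigcup_i\mathsf{sub_A}(\alpha_i)$ for $\beta=\langle\alpha_1,\dots,\alpha_n\hookrightarrow\varphi\rangle$; $\mathsf{TopRule}(\langle\alpha_1,\dots,\alpha_n\hookrightarrow\varphi\rangle)=((\mathsf{Conc}(\alpha_1),\dots,\mathsf{Conc}(\alpha_n)),\varphi)$;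 $\mathsf{DefRule}(\langle\varphi\rangle)=\emptyset$, $\mathsf{DefRule}(\langle\alpha_1,\dots,\alpha_n\twoheadrightarrow\varphi\rangle)=\bigcup_i\mathsf{DefRule}(\alpha_i)$, $\mathsf{DefRule}(\langle\alpha_1,\dots,\alpha_n\Rightarrow\varphi\rangle)=\{\mathsf{TopRule}\}\cup\bigcup_i\mathsf{DefRule}(\alpha_i)$. $\mathsf{SEQ}(\mathsf{F})$ is the set of finite sequences $((\varphi_1,\dots,\varphi_n),\varphi)$ over $\mathsf{F}$. A model $M=(W,\mathcal{B},\mathcal{O},\mathcal{D},\mathfrak{n},\|\cdot\|)$: $W\ne\emptyset$; $\emptyset\ne\mathcal{B}\subseteq W$; $\mathcal{O}\subseteq\mathsf{A}$ (awareness set); $\mathcal{D}\subseteq\mathsf{SEQ}(\mathsf{F})$ with each $((\varphi_1,\dots,\varphi_n),\varphi)\in\mathcal{D}$ satisfying $\{\varphi_1,\dots,\varphi_n,\varphi\}\nvdash_0\perp$ and $\{\varphi_1,\dots,\varphi_n\}\nvdash_0\varphi$; $\mathfrak{n}:\mathsf{SEQ}(\mathsf{F})\to\mathsf{At}$ partial; $\|\cdot\|:\mathsf{At}\to\wp(W)$. $WS^M$ is the smallest set of arguments containing all $\langle\varphi\rangle$, containing $\langle\alpha_1,\dots,\alpha_n\twoheadrightarrow\varphi\rangle$ iff all $\alpha_i\in WS^M$ and $\{\mathsf{Conc}(\alpha_i)\}_i\vdash_0\varphi$, and containing $\langle\alpha_1,\dots,\alpha_n\Rightarrow\varphi\rangle$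 iff all $\alpha_i\in WS^M$ and $((\mathsf{Conc}(\alpha_1),\dots,\mathsf{Conc}(\alpha_n)),\varphi)\in\mathcal{D}$. Truth: $p$ true at $w$ iff $w\in\|p\|$; Booleans standard; $\square\varphi$ iff $\varphi$ holds at all worlds of $\mathcal{B}$; $\mathsf{aware}(\alpha)$ iff $\alpha\in\mathcal{O}$; $\mathsf{conc}(\alpha)=\varphi$ iff $\mathsf{Conc}(\alpha)=\varphi$; $\mathsf{strict}(\alpha)$ iff $\mathsf{DefRule}(\alpha)=\emptyset$; $\mathsf{undercuts}(\alpha,\beta)$ iff $\beta=\langle\beta_1,\dots,\beta_n\Rightarrow\psi\rangle$ and $\mathsf{Conc}(\alpha)=\lnot\mathfrak{n}(\mathsf{TopRule}(\beta))$; $\mathsf{wellshap}(\alpha)$ iff $\alpha\in WS^M$. Abbreviations: $\varphi=\sim\psi$ abbreviates $\mathsf{wellshap}(\langle\langle\varphi\rangle\twoheadrightarrow\lnot\psi\rangle)\land\mathsf{wellshap}(\langle\langle\psi\rangle\twoheadrightarrow\lnot\varphi\rangle)$ (i.e. $\varphi\vdash_0\lnot\psi$ and $\psi\vdash_0\lnot\varphi$). $\mathsf{accept}(\alpha):=\bigwedge_{\varphi\in\mathsf{Prem}(\alpha)}\square\varphi$. $\alpha\ge\beta:=\mathsf{strict}(\alpha)\lor\lnot\mathsf{strict}(\beta)$. $\mathsf{undercuts}^*(\alpha,\beta):=\bigvee_{\beta'\in\mathsf{sub_A}(\beta)}\mathsf{undercuts}(\alpha,\beta')$. Unrestricted rebuttal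 $\mathsf{U}\mathsf{rebuts}(\alpha,\beta)$: $\lnot\mathsf{strict}(\beta)$ and for some $\beta'\in\mathsf{sub_A}(\beta)$, $\mathsf{Conc}(\alpha)=\sim\mathsf{Conc}(\beta')$ and $\alpha\ge\beta'$. Restricted rebuttal $\mathsf{R}\mathsf{rebuts}(\alpha,\beta)$: $\lnot\mathsf{strict}(\beta)$ and for some subargument $\langle\beta_1,\dots,\beta_n\Rightarrow\varphi\rangle\in\mathsf{sub_A}(\beta)$, $\varphi=\sim\mathsf{Conc}(\alpha)$. $\mathsf{defeat}(\alpha,\beta):=\mathsf{undercuts}^*(\alpha,\beta)\lor\mathsf{U}\mathsf{rebuts}(\alpha,\beta)$ (in the restricted variant, $\mathsf{R}\mathsf{rebuts}$ replaces $\mathsf{U}\mathsf{rebuts}$). The associated argumentation framework of pointed model $(M,w)$ is $AF^M=(\mathsf{A}^M,\rightsquigarrow)$ with $\mathsf{A}^M=\{\alpha\in\mathsf{A}: M,w\models\mathsf{aware}(\alpha)\land\mathsf{wellshap}(\alpha)\land\mathsf{accept}(\alpha)\}$ and $\alpha\rightsquigarrow\beta$ iff $M,w\models\mathsf{defeat}(\alpha,\beta)$. $X\subseteq\mathsf{A}^M$ is conflict-free if no $\alpha,\beta\in X$ with $\alpha\rightsquigarrow\beta$; $X$ defends $\alpha$ if every $\gamma\rightsquigarrow\alpha$ is defeated by some member of $X$; a complete extension is a conflict-free $X$ equal to the set of arguments it defends; $GE(AF^M)$ is the (unique) smallest complete extension. The formula $\mathsf{B}(\alpha,\varphi)$ is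 true at $(M,w)$ iff $\alpha\in GE(AF^M)$ and $\mathsf{Conc}(\alpha)=\varphi$. -}

module Defs where

open import Data.Nat using (ℕ)
open import Data.Empty using (⊥)
open import Data.Unit using (⊤)
open import Data.Maybe using (Maybe; just)
open import Data.Product using (Σ; Σ-syntax; _×_; _,_; proj₁; proj₂)
open import Data.Sum using (_⊎_)
open import Data.List using (List; []; _∷_; map)
open import Data.List.NonEmpty using (List⁺; toList; [_])
open import Data.List.Membership.Propositional using (_∈_)
open import Data.List.Relation.Unary.All using (All)
open import Relation.Nullary using (¬_)
open import Relation.Binary.PropositionalEquality using (_≡_)
open import Function.Bundles using (_⇔_)

infix  8 ¬ᶠ_
infixr 7 _∧ᶠ_
infix  5 _↠_ _⇒_

mutual
  data Fm : Set where
    atom      : ℕ → Fm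
    ¬ᶠ_       : Fm → Fm
    _∧ᶠ_      : Fm → Fm → Fm
    □_        : Fm → Fm
    aware     : Arg → Fm
    conc_≐_   : Arg → Fm → Fm
    strict    : Arg → Fm
    undercuts : Arg → Arg → Fm
    wellshap  : Arg → Fm

  data Arg : Set where
    ⟨_⟩   : Fm → Arg
    _↠_   : List⁺ Arg → Fm → Arg
    _⇒_   : List⁺ Arg → Fm → Arg

SEQ : Set
SEQ = List Fm × Fm

Conc : Arg → Fm
Conc ⟨ φ ⟩    = φ
Conc (_ ↠ φ) = φ
Conc (_ ⇒ φ) = φ

topRule : List⁺ Arg → Fm → SEQ
topRule αs φ = map Conc (toList αs) , φ

data _⊑_ : Arg → Arg → Set where
  ⊑-refl : ∀ {α} → α ⊑ α
  ⊑-↠    : ∀ {β γ αs φ} → β ⊑ γ → γ ∈ toList αs → β ⊑ (αs ↠ φ)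
  ⊑-⇒    : ∀ {β γ αs φ} → β ⊑ γ → γ ∈ toList αs → β ⊑ (αs ⇒ φ)

data PremOf : Fm → Arg → Set where
  prem-⟨⟩ : ∀ {φ} → PremOf φ ⟨ φ ⟩
  prem-↠  : ∀ {φ γ αs ψ} → PremOf φ γ → γ ∈ toList αs → PremOf φ (αs ↠ ψ)
  prem-⇒  : ∀ {φ γ αs ψ} → PremOf φ γ → γ ∈ toList αs → PremOf φ (αs ⇒ ψ)

data DefRuleOf : SEQ → Arg → Set where
  dr-top : ∀ {αs φ} → DefRuleOf (topRule αs φ) (αs ⇒ φ)
  dr-↠   : ∀ {r γ αs φ} → DefRuleOf r γ → γ ∈ toList αs → DefRuleOf r (αs ↠ φ)
  dr-⇒   : ∀ {r γ αs φ} → DefRuleOf r γ → γ ∈ toList αs → DefRuleOf r (αs ⇒ φ)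

Strict : Arg → Set
Strict α = ∀ r → ¬ DefRuleOf r α

-- Classical propositional consequence ⊢₀ (non-Boolean formulas are
-- propositional atoms).  Natural deduction for {¬, ∧} with reductio.

infix 4 _⊢ᴸ_ _⊢₀_

data _⊢ᴸ_ : List Fm → Fm → Set where
  ax   : ∀ {Δ φ} → φ ∈ Δ → Δ ⊢ᴸ φ
  ∧I   : ∀ {Δ φ ψ} → Δ ⊢ᴸ φ → Δ ⊢ᴸ ψ → Δ ⊢ᴸ φ ∧ᶠ ψ
  ∧E₁  : ∀ {Δ φ ψ} → Δ ⊢ᴸ φ ∧ᶠ ψ → Δ ⊢ᴸ φ
  ∧E₂  : ∀ {Δ φ ψ} → Δ ⊢ᴸ φ ∧ᶠ ψ → Δ ⊢ᴸ ψ
  ¬I   : ∀ {Δ φ ψ} → (φ ∷ Δ) ⊢ᴸ ψ → (φ ∷ Δ) ⊢ᴸ ¬ᶠ ψ → Δ ⊢ᴸ ¬ᶠ φ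
  raa  : ∀ {Δ φ ψ} → (¬ᶠ φ ∷ Δ) ⊢ᴸ ψ → (¬ᶠ φ ∷ Δ) ⊢ᴸ ¬ᶠ ψ → Δ ⊢ᴸ φ

_⊢₀_ : (Fm → Set) → Fm → Set
Γ ⊢₀ φ = Σ[ Δ ∈ List Fm ] (All Γ Δ × Δ ⊢ᴸ φ)

Inconsistent : (Fm → Set) → Set
Inconsistent Γ = Σ[ ψ ∈ Fm ] (Γ ⊢₀ ψ × Γ ⊢₀ ¬ᶠ ψ)

⟦_⟧ : List Fm → (Fm → Set)
⟦ Δ ⟧ χ = χ ∈ Δ

record Model : Set₁ where
  field
    W            : Set
    ℬ            : W → Set
    ℬ-nonempty   : Σ W ℬ
    𝒪            : Arg → Set
    𝒟            : SEQ → Set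
    𝒟-consistent : ∀ φs φ → 𝒟 (φs , φ) → ¬ Inconsistent ⟦ φ ∷ φs ⟧
    𝒟-nonstrict  : ∀ φs φ → 𝒟 (φs , φ) → ¬ (⟦ φs ⟧ ⊢₀ φ)
    𝔫            : SEQ → Maybe ℕ
    ∥_∥          : ℕ → W → Set

module _ (M : Model) where
  open Model M

  data WS : Arg → Set where
    ws-⟨⟩ : ∀ {φ} → WS ⟨ φ ⟩
    ws-↠  : ∀ {αs φ} → All WS (toList αs) → ⟦ map Conc (toList αs) ⟧ ⊢₀ φ → WS (αs ↠ φ)
    ws-⇒  : ∀ {αs φ} → All WS (toList αs) → 𝒟 (topRule αs φ) → WS (αs ⇒ φ)

  Undercuts : Arg → Arg → Set
  Undercuts α ⟨ _ ⟩    = ⊥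
  Undercuts α (_ ↠ _) = ⊥
  Undercuts α (βs ⇒ ψ) = Σ[ p ∈ ℕ ] (𝔫 (topRule βs ψ) ≡ just p × Conc α ≡ ¬ᶠ atom p)

  infix 3 _⊨_
  _⊨_ : W → Fm → Set
  w ⊨ atom p          = ∥ p ∥ w
  w ⊨ ¬ᶠ φ            = ¬ (w ⊨ φ)
  w ⊨ φ ∧ᶠ ψ          = (w ⊨ φ) × (w ⊨ ψ)
  w ⊨ □ φ             = ∀ u → ℬ u → u ⊨ φ
  w ⊨ aware α         = 𝒪 α
  w ⊨ conc α ≐ φ      = Conc α ≡ φ
  w ⊨ strict α        = Strict α
  w ⊨ undercuts α β   = Undercuts α β
  w ⊨ wellshap α      = WS α

contrary : Fm → Fm → Fm
contrary φ ψ = wellshap ([ ⟨ φ ⟩ ] ↠ ¬ᶠ ψ) ∧ᶠ wellshap ([ ⟨ ψ ⟩ ] ↠ ¬ᶠ φ)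

data Rebuttal : Set where
  unrestricted restricted : Rebuttal

module AF (M : Model) (w : Model.W M) (rb : Rebuttal) where
  open Model M

  Accept : Arg → Set
  Accept α = ∀ φ → PremOf φ α → _⊨_ M w (□ φ)

  InAF : Arg → Set
  InAF α = _⊨_ M w (aware α) × _⊨_ M w (wellshap α) × Accept α

  Undercuts* : Arg → Arg → Set
  Undercuts* α β = Σ[ β' ∈ Arg ] (β' ⊑ β × _⊨_ M w (undercuts α β'))

  Geq : Arg → Arg → Set
  Geq α β = _⊨_ M w (strict α) ⊎ _⊨_ M w (¬ᶠ strict β)

  URebuts : Arg → Arg → Set
  URebuts α β = _⊨_ M w (¬ᶠ strict β) ×
    Σ[ β' ∈ Arg ] (β' ⊑ β × _⊨_ M w (contrary (Conc α) (Conc β'))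
                         × Geq α β')


  RRebuts : Arg → Arg → Set
  RRebuts α β = _⊨_ M w (¬ᶠ strict β) ×
    Σ[ βs ∈ List⁺ Arg ] Σ[ φ ∈ Fm ] ((βs ⇒ φ) ⊑ β × _⊨_ M w (contrary φ (Conc α)))

  rebutsFor : Rebuttal → Arg → Arg → Set
  rebutsFor unrestricted = URebuts
  rebutsFor restricted   = RRebuts

  Rebuts : Arg → Arg → Set
  Rebuts = rebutsFor rb

  _⇝_ : Arg → Arg → Set
  α ⇝ β = Undercuts* α β ⊎ Rebuts α β

  ConflictFree : (Arg → Set) → Set
  ConflictFree X = ∀ α β → X α → X β → ¬ (α ⇝ β)

  Defends : (Arg → Set) → Arg → Set
  Defends X α = ∀ γ → InAF γ → γ ⇝ α → Σ[ δ ∈ Arg ] (X δ × δ ⇝ γ)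

  Complete : (Arg → Set) → Set
  Complete X = (∀ α → X α → InAF α) × ConflictFree X
             × (∀ α → X α ⇔ (InAF α × Defends X α))

  Grounded : (Arg → Set) → Set₁
  Grounded X = Complete X × (∀ Y → Complete Y → ∀ α → X α → Y α)

  Bel : (Arg → Set) → Arg → Fm → Set
  Bel G α φ = G α × Conc α ≡ φ

  ConcSet : (Arg → Set) → Fm → Set
  ConcSet G φ = Σ[ α ∈ Arg ] (G α × Conc α ≡ φ)

  DirectConsistent : (Arg → Set) → Set
  DirectConsistent G = ¬ (Σ[ α ∈ Arg ] Σ[ β ∈ Arg ] Σ[ φ ∈ Fm ] Σ[ ψ ∈ Fm ]
    (Bel G α φ × Bel G β ψ × _⊨_ M w (contrary φ ψ)))

  IndirectConsistent : (Arg → Set) → Set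
  IndirectConsistent G = ¬ Inconsistent (ConcSet G)

  SubArgClosed : (Arg → Set) → Set
  SubArgClosed G = ∀ α β → G α → β ⊑ α → G β

  StrictClosed : (Arg → Set) → Set
  StrictClosed G = ∀ φ → ConcSet G ⊢₀ φ → ConcSet G φ

{-# OPTIONS --safe #-}
module Submission where

open import Defs
open import Data.Product using (_×_; Σ-syntax; _,_; proj₁; proj₂)
open import Data.Sum using (inj₁; inj₂)
open import Data.Empty using (⊥-elim)
open import Data.List using (List; []; _∷_; map)
open import Data.List.NonEmpty using (List⁺; toList) renaming (_∷_ to _∷⁺_)
open import Data.List.Membership.Propositional using (_∈_)
open import Data.List.Membership.Propositional.Properties using (∈-map⁻)
open import Data.List.Relation.Binary.Subset.Propositional using (_⊆_)
open import Data.List.Relation.Binary.Subset.Propositional.Properties using (∷⁺ʳ)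
open import Data.List.Relation.Unary.All as All using (All; []; _∷_; lookup)
open import Data.List.Relation.Unary.Any using (here; there)
open import Relation.Nullary using (¬_)
open import Relation.Nullary.Negation using (DoubleNegation; contradiction)
open import Relation.Binary.PropositionalEquality using (refl; sym; subst)
open import Function.Bundles using (Equivalence)
open import Function using (_∘_)

-- If two arguments of a conflict-free set had contrary conclusions, each
-- would be strict: under unrestricted rebuttal a non-strict one is rebutted
-- by the other directly, and under restricted rebuttal a complete extension
-- is closed under subarguments and strict inferences, so from the two
-- conclusions it would infer ¬ χ for the head χ of any defeasible rule used,
-- and that argument rebuts the rule.  But strict arguments are classical
-- inferences from premises true throughout the nonempty ℬ, so their
-- conclusions are jointly satisfiable and cannot be contrary.

⊑-trans : ∀ {α β γ} → α ⊑ β → β ⊑ γ → α ⊑ γ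
⊑-trans p ⊑-refl    = p
⊑-trans p (⊑-↠ q m) = ⊑-↠ (⊑-trans p q) m
⊑-trans p (⊑-⇒ q m) = ⊑-⇒ (⊑-trans p q) m

DefRuleOf-⊑ : ∀ {r α β} → DefRuleOf r α → α ⊑ β → DefRuleOf r β
DefRuleOf-⊑ d ⊑-refl    = d
DefRuleOf-⊑ d (⊑-↠ q m) = dr-↠ (DefRuleOf-⊑ d q) m
DefRuleOf-⊑ d (⊑-⇒ q m) = dr-⇒ (DefRuleOf-⊑ d q) m

Strict-⊑ : ∀ {α β} → α ⊑ β → Strict β → Strict α
Strict-⊑ sub s r d = s r (DefRuleOf-⊑ d sub)

PremOf-⊑ : ∀ {φ α β} → PremOf φ α → α ⊑ β → PremOf φ β
PremOf-⊑ p ⊑-refl    = p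
PremOf-⊑ p (⊑-↠ q m) = prem-↠ (PremOf-⊑ p q) m
PremOf-⊑ p (⊑-⇒ q m) = prem-⇒ (PremOf-⊑ p q) m

WS-⊑ : ∀ {M α β} → WS M β → α ⊑ β → WS M α
WS-⊑ ws           ⊑-refl    = ws
WS-⊑ (ws-↠ wss _) (⊑-↠ q m) = WS-⊑ (lookup wss m) q
WS-⊑ (ws-⇒ wss _) (⊑-⇒ q m) = WS-⊑ (lookup wss m) q

DefRuleOf⇒defeasible-subarg : ∀ {r β} → DefRuleOf r β →
  Σ[ βs ∈ List⁺ Arg ] Σ[ χ ∈ Fm ] ((βs ⇒ χ) ⊑ β)
DefRuleOf⇒defeasible-subarg dr-top = _ , _ , ⊑-refl
DefRuleOf⇒defeasible-subarg (dr-↠ d m) with DefRuleOf⇒defeasible-subarg d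
... | βs , χ , sub = βs , χ , ⊑-↠ sub m
DefRuleOf⇒defeasible-subarg (dr-⇒ d m) with DefRuleOf⇒defeasible-subarg d
... | βs , χ , sub = βs , χ , ⊑-⇒ sub m

⟨⟩-strict : ∀ {φ} → Strict ⟨ φ ⟩
⟨⟩-strict _ ()

⊢ᴸ-weaken : ∀ {Δ Γ φ} → Δ ⊢ᴸ φ → Δ ⊆ Γ → Γ ⊢ᴸ φ
⊢ᴸ-weaken (ax m)    ρ = ax (ρ m)
⊢ᴸ-weaken (∧I d e)  ρ = ∧I (⊢ᴸ-weaken d ρ) (⊢ᴸ-weaken e ρ)
⊢ᴸ-weaken (∧E₁ d)   ρ = ∧E₁ (⊢ᴸ-weaken d ρ)
⊢ᴸ-weaken (∧E₂ d)   ρ = ∧E₂ (⊢ᴸ-weaken d ρ)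
⊢ᴸ-weaken (¬I d e)  ρ = ¬I (⊢ᴸ-weaken d (∷⁺ʳ _ ρ)) (⊢ᴸ-weaken e (∷⁺ʳ _ ρ))
⊢ᴸ-weaken (raa d e) ρ = raa (⊢ᴸ-weaken d (∷⁺ʳ _ ρ)) (⊢ᴸ-weaken e (∷⁺ʳ _ ρ))

module Contrary (M : Model) (u : Model.W M) where

  contrary-sym : ∀ {φ ψ} → _⊨_ M u (contrary φ ψ) → _⊨_ M u (contrary ψ φ)
  contrary-sym (φ⊢¬ψ , ψ⊢¬φ) = ψ⊢¬φ , φ⊢¬ψ

  contrary-¬ : ∀ φ → _⊨_ M u (contrary φ (¬ᶠ φ))
  contrary-¬ φ =
      ws-↠ (ws-⟨⟩ ∷ []) (φ ∷ [] , here refl ∷ [] , ¬I (ax (there (here refl))) (ax (here refl)))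
    , ws-↠ (ws-⟨⟩ ∷ []) (¬ᶠ φ ∷ [] , here refl ∷ [] , ax (here refl))

  contrary⇒explosive : ∀ {φ ψ} χ → _⊨_ M u (contrary φ ψ) → (φ ∷ ψ ∷ []) ⊢ᴸ ¬ᶠ χ
  contrary⇒explosive {φ} {ψ} χ (ws-↠ _ (Δ , Δ⊆[φ] , Δ⊢¬ψ) , _) =
    ¬I (ax (there (there (here refl)))) (⊢ᴸ-weaken Δ⊢¬ψ Δ⊆χφψ)
    where
    Δ⊆χφψ : Δ ⊆ (χ ∷ φ ∷ ψ ∷ [])
    Δ⊆χφψ m with lookup Δ⊆[φ] m
    ... | here refl = there (here refl)

-- Satisfaction is constructive while ⊢ᴸ has reductio, so soundness only
-- holds up to double negation; that suffices to refute contrariness.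
module Soundness (M : Model) where
  open Model M

  ⊢ᴸ-sound : ∀ {u Δ φ} → Δ ⊢ᴸ φ →
    All (λ χ → DoubleNegation (_⊨_ M u χ)) Δ → DoubleNegation (_⊨_ M u φ)
  ⊢ᴸ-sound (ax m)    h = lookup h m
  ⊢ᴸ-sound (∧I d e)  h k = ⊢ᴸ-sound d h (λ a → ⊢ᴸ-sound e h (λ b → k (a , b)))
  ⊢ᴸ-sound (∧E₁ d)   h k = ⊢ᴸ-sound d h (λ ab → k (proj₁ ab))
  ⊢ᴸ-sound (∧E₂ d)   h k = ⊢ᴸ-sound d h (λ ab → k (proj₂ ab))
  ⊢ᴸ-sound (¬I d e)  h k = k (λ a → let h′ = contradiction a ∷ h in ⊢ᴸ-sound e h′ (⊢ᴸ-sound d h′))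
  ⊢ᴸ-sound (raa d e) h k = let h′ = contradiction k ∷ h in ⊢ᴸ-sound e h′ (⊢ᴸ-sound d h′)

  PremisesHold : W → Arg → Set
  PremisesHold u α = ∀ φ → PremOf φ α → _⊨_ M u φ

  mutual
    strict-sound : ∀ {u α} → WS M α → Strict α → PremisesHold u α →
      DoubleNegation (_⊨_ M u (Conc α))
    strict-sound ws-⟨⟩       _      premises = contradiction (premises _ prem-⟨⟩)
    strict-sound (ws-⇒ _ _)  isStrict _      = ⊥-elim (isStrict _ dr-top)
    strict-sound {u} (ws-↠ {αs} wss (Δ , Δ⊆ , Δ⊢φ)) isStrict premises =
      ⊢ᴸ-sound Δ⊢φ (All.map conclusion-sound Δ⊆)
      where
      children : All (λ γ → DoubleNegation (_⊨_ M u (Conc γ))) (toList αs)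
      children = strict-sound-all wss λ m →
        (λ r d → isStrict r (dr-↠ d m)) , (λ φ p → premises φ (prem-↠ p m))

      conclusion-sound : ∀ {χ} → χ ∈ map Conc (toList αs) → DoubleNegation (_⊨_ M u χ)
      conclusion-sound m with ∈-map⁻ Conc m
      ... | _ , γ∈αs , refl = lookup children γ∈αs

    strict-sound-all : ∀ {u γs} → All (WS M) γs →
      (∀ {γ} → γ ∈ γs → Strict γ × PremisesHold u γ) →
      All (λ γ → DoubleNegation (_⊨_ M u (Conc γ))) γs
    strict-sound-all []         _ = []
    strict-sound-all (ws ∷ wss) h =
      strict-sound ws (proj₁ (h (here refl))) (proj₂ (h (here refl)))
      ∷ strict-sound-all wss (λ m → h (there m))

module _ (M : Model) (w : Model.W M) where

  rebuts⇒nonstrict : ∀ rb {γ β} → AF.Rebuts M w rb γ β → ¬ Strict β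
  rebuts⇒nonstrict unrestricted (nonstrict , _) = nonstrict
  rebuts⇒nonstrict restricted   (nonstrict , _) = nonstrict

  ⟨⟩-unattacked : ∀ rb {γ φ} → ¬ AF._⇝_ M w rb γ ⟨ φ ⟩
  ⟨⟩-unattacked rb (inj₁ (_ , ⊑-refl , ()))
  ⟨⟩-unattacked rb (inj₂ rebut) = rebuts⇒nonstrict rb rebut ⟨⟩-strict

  ⇝-⊑ : ∀ rb {γ α β} → α ⊑ β → AF._⇝_ M w rb γ α → AF._⇝_ M w rb γ β
  ⇝-⊑ rb sub (inj₁ (α′ , α′⊑α , u)) = inj₁ (α′ , ⊑-trans α′⊑α sub , u)
  ⇝-⊑ unrestricted sub (inj₂ (nonstrict , α′ , α′⊑α , c , geq)) =
    inj₂ ((nonstrict ∘ Strict-⊑ sub) , α′ , ⊑-trans α′⊑α sub , c , geq)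
  ⇝-⊑ restricted sub (inj₂ (nonstrict , αs , φ , α′⊑α , c)) =
    inj₂ ((nonstrict ∘ Strict-⊑ sub) , αs , φ , ⊑-trans α′⊑α sub , c)

module _ (M : Model) (w : Model.W M) (rb : Rebuttal) where
  open Model M
  open AF M w rb
  open Soundness M

  InAF-⊑ : (∀ α → 𝒪 α) → ∀ {α β} → InAF β → α ⊑ β → InAF α
  InAF-⊑ allAware (_ , ws , accept) sub =
    allAware _ , WS-⊑ ws sub , λ φ p → accept φ (PremOf-⊑ p sub)

  strict-noncontrary : ∀ {α β} → InAF α → InAF β → Strict α → Strict β →
    ¬ _⊨_ M w (contrary (Conc α) (Conc β))
  strict-noncontrary {α} (_ , wsα , acceptα) (_ , wsβ , acceptβ) sα sβ
                     (ws-↠ _ (Δ , Δ⊆[α] , Δ⊢¬β) , _) =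
    ⊢ᴸ-sound Δ⊢¬β (All.map α-sound Δ⊆[α]) (strict-sound wsβ sβ (λ φ p → acceptβ φ p u u∈ℬ))
    where
    u : W
    u = proj₁ ℬ-nonempty

    u∈ℬ : ℬ u
    u∈ℬ = proj₂ ℬ-nonempty

    α-sound : ∀ {χ} → χ ∈ Conc α ∷ [] → DoubleNegation (_⊨_ M u χ)
    α-sound (here refl) = strict-sound wsα sα (λ φ p → acceptα φ p u u∈ℬ)

  module CompleteExtension {G : Arg → Set} (complete : Complete G) where

    G⊆AF : ∀ {α} → G α → InAF α
    G⊆AF = proj₁ complete _

    conflictFree : ConflictFree G
    conflictFree = proj₁ (proj₂ complete)

    defends : ∀ {α} → G α → Defends G α
    defends Gα = proj₂ (Equivalence.to (proj₂ (proj₂ complete) _) Gα)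

    defended⇒∈ : ∀ {α} → InAF α → Defends G α → G α
    defended⇒∈ inAF def = Equivalence.from (proj₂ (proj₂ complete) _) (inAF , def)

    unattacked⇒∈ : ∀ {α} → InAF α → (∀ γ → ¬ γ ⇝ α) → G α
    unattacked⇒∈ inAF unattacked =
      defended⇒∈ inAF (λ γ _ att → contradiction att (unattacked γ))

    subargClosed : (∀ α → 𝒪 α) → SubArgClosed G
    subargClosed allAware α β Gα sub = defended⇒∈ (InAF-⊑ allAware (G⊆AF Gα) sub)
      λ γ inAF att → defends Gα γ inAF (⇝-⊑ M w rb sub att)

conflictFree⇒directConsistent : ∀ M w {G} → (∀ α → G α → AF.InAF M w unrestricted α) →
  AF.ConflictFree M w unrestricted G → AF.DirectConsistent M w unrestricted G
conflictFree⇒directConsistent M w {G} G⊆AF conflictFree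
  (α , β , _ , _ , (Gα , refl) , (Gβ , refl) , c) =
  strict-noncontrary M w unrestricted (G⊆AF α Gα) (G⊆AF β Gβ)
    (strict-if-contrary Gβ Gα (contrary-sym c)) (strict-if-contrary Gα Gβ c) c
  where
  open Contrary M w

  strict-if-contrary : ∀ {α β} → G α → G β →
    _⊨_ M w (contrary (Conc α) (Conc β)) → Strict β
  strict-if-contrary {α} {β} Gα Gβ c r d =
    conflictFree α β Gα Gβ (inj₂ (nonstrict , β , ⊑-refl , c , inj₂ nonstrict))
    where
    nonstrict : ¬ Strict β
    nonstrict s = s r d

module _ (M : Model) (w : Model.W M) where
  open Model M
  open AF M w restricted
  open Contrary M w

  restricted-↠-attack⇒child-attack : ∀ {γ αs φ} → γ ⇝ (αs ↠ φ) →
    Σ[ α ∈ Arg ] (α ∈ toList αs × γ ⇝ α)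
  restricted-↠-attack⇒child-attack (inj₁ (_ , ⊑-refl , ()))
  restricted-↠-attack⇒child-attack (inj₁ (β′ , ⊑-↠ q m , u)) = _ , m , inj₁ (β′ , q , u)
  restricted-↠-attack⇒child-attack (inj₂ (_ , βs , ψ , ⊑-↠ q m , c)) =
    _ , m , inj₂ ((λ s → s _ (DefRuleOf-⊑ dr-top q)) , βs , ψ , q , c)

  module RestrictedCompleteExtension (allAware : ∀ α → 𝒪 α)
         {G : Arg → Set} (complete : Complete G) where
    open CompleteExtension M w restricted complete

    ↠-closed : ∀ {αs φ} → All G (toList αs) → ⟦ map Conc (toList αs) ⟧ ⊢₀ φ → G (αs ↠ φ)
    ↠-closed {αs} {φ} Gαs derivation = defended⇒∈ (allAware _ , wellShaped , accept) defended
      where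
      wellShaped : WS M (αs ↠ φ)
      wellShaped = ws-↠ (All.map (λ Gα → proj₁ (proj₂ (G⊆AF Gα))) Gαs) derivation

      accept : Accept (αs ↠ φ)
      accept ψ (prem-↠ p m) = proj₂ (proj₂ (G⊆AF (lookup Gαs m))) ψ p

      defended : Defends G (αs ↠ φ)
      defended δ inAF att with restricted-↠-attack⇒child-attack att
      ... | _ , m , att′ = defends (lookup Gαs m) δ inAF att′

    ⊤ᶠ : Fm
    ⊤ᶠ = ¬ᶠ (atom 0 ∧ᶠ ¬ᶠ atom 0)

    ⊤ᶠ∈G : G ⟨ ⊤ᶠ ⟩
    ⊤ᶠ∈G = unattacked⇒∈ (allAware _ , ws-⟨⟩ , accept) (λ _ → ⟨⟩-unattacked M w restricted)
      where
      accept : Accept ⟨ ⊤ᶠ ⟩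
      accept _ prem-⟨⟩ _ _ (p , ¬p) = ¬p p

    ConcSet-witnesses : ∀ {Δ} → All (ConcSet G) Δ →
      Σ[ αs ∈ List Arg ] (All G αs × All (_∈ map Conc αs) Δ)
    ConcSet-witnesses [] = [] , [] , []
    ConcSet-witnesses ((α , Gα , refl) ∷ rest) with ConcSet-witnesses rest
    ... | αs , Gαs , Δ⊆ = α ∷ αs , Gα ∷ Gαs , here refl ∷ All.map there Δ⊆

    -- ⟨ ⊤ᶠ ⟩ pads the premises, since a strict step needs at least one.
    strictClosed : StrictClosed G
    strictClosed φ (Δ , Δ⊆G , Δ⊢φ) with ConcSet-witnesses Δ⊆G
    ... | αs , Gαs , Δ⊆αs =
      (⟨ ⊤ᶠ ⟩ ∷⁺ αs) ↠ φ , ↠-closed (⊤ᶠ∈G ∷ Gαs) (Δ , All.map there Δ⊆αs , Δ⊢φ) , refl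

    contrary⇒strict : ∀ {α β} → G α → G β → _⊨_ M w (contrary (Conc α) (Conc β)) → Strict β
    contrary⇒strict {α} {β} Gα Gβ c _ d with DefRuleOf⇒defeasible-subarg d
    ... | βs , χ , sub
        with strictClosed (¬ᶠ χ) (_ , (α , Gα , refl) ∷ (β , Gβ , refl) ∷ [] ,
                                   contrary⇒explosive χ c)
    ... | γ , Gγ , Conc-γ≡¬χ =
      conflictFree γ (βs ⇒ χ) Gγ (subargClosed allAware β _ Gβ sub)
        (inj₂ ((λ s → s _ dr-top) , βs , χ , ⊑-refl ,
               subst (λ ψ → _⊨_ M w (contrary χ ψ)) (sym Conc-γ≡¬χ) (contrary-¬ χ)))

    directConsistent : DirectConsistent G
    directConsistent (α , β , _ , _ , (Gα , refl) , (Gβ , refl) , c) =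
      strict-noncontrary M w restricted (G⊆AF Gα) (G⊆AF Gβ)
        (contrary⇒strict Gβ Gα (contrary-sym c)) (contrary⇒strict Gα Gβ c) c

    indirectConsistent : IndirectConsistent G
    indirectConsistent (ψ , Γ⊢ψ , Γ⊢¬ψ) with strictClosed ψ Γ⊢ψ | strictClosed (¬ᶠ ψ) Γ⊢¬ψ
    ... | α , Gα , Conc-α≡ψ | β , Gβ , Conc-β≡¬ψ =
      directConsistent (α , β , ψ , ¬ᶠ ψ , (Gα , Conc-α≡ψ) , (Gβ , Conc-β≡¬ψ) , contrary-¬ ψ)

proposition1 : (M : Model) (w : Model.W M) →
    (∀ G → AF.Grounded M w unrestricted G → AF.DirectConsistent M w unrestricted G)
    × ((∀ α → Model.𝒪 M α) → ∀ G → AF.Grounded M w restricted G →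
        AF.DirectConsistent M w restricted G × AF.IndirectConsistent M w restricted G
        × AF.SubArgClosed M w restricted G × AF.StrictClosed M w restricted G)
proposition1 M w =
    (λ G ((G⊆AF , conflictFree , _) , _) →
       conflictFree⇒directConsistent M w G⊆AF conflictFree)
  , λ allAware G (complete , _) →
      let open RestrictedCompleteExtension M w allAware complete
          open CompleteExtension M w restricted complete using (subargClosed)
      in directConsistent , indirectConsistent , subargClosed allAware , strictClosed
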